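{- Let $G$ be a graph with vertices $v_1,\dots,v_n$ and let $H_1,\dots,H_n$ be graphs (where $H_i$ is allowed to have no vertices). Then \[ Z(G\prec H_1,\dots,H_n\succ)\le Z(G)+\sum_{i=1}^n Z(H_i), \] with the convention $Z(H_i)=0$ if $H_i$ has no vertices.
   Context: All graphs are finite, simple and undirected. Zero forcing: vertices are coloured black or white; if a black vertex $u$ has exactly one white neighbour $v$, then $v$ is recoloured black. A set $Z\subseteq V(G)$ is a zero forcing set if, starting with $Z$ black and all other vertices white, repeated application of this rule colours all vertices black; $Z(G)$ is the minimum size of a zero forcing set. The generalized corona $G\prec H_1,\dots,H_n\succ$ is obtained from the disjoint union of $G,H_1,\dots,H_n$ by joining every vertex of $H_i$ to the $i$-th vertex $v_i$ of $G$, for $i=1,\dots,n$ (if $H_i$ has no vertices, nothing is attached to $v_i$). -}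

module Defs where

open import Data.Nat using (ℕ; _≤_; _+_)
open import Data.Sum using (_⊎_; inj₁; inj₂)
open import Data.Product using (Σ; _×_; _,_; ∃)
open import Data.List using (List; length)
open import Data.List.Membership.Propositional using (_∈_)
open import Data.List.Relation.Unary.Unique.Propositional using (Unique)
open import Relation.Binary.PropositionalEquality using (_≡_)
open import Relation.Nullary using (¬_)

record SimpleGraph : Set₁ where
  field
    V        : Set
    _~_      : V → V → Set
    sym~     : ∀ {u v} → u ~ v → v ~ u
    irrefl~  : ∀ {v} → ¬ (v ~ v)
open SimpleGraph public

record Graph : Set₁ where
  field
    graph          : SimpleGraph
    verts          : List (V graph)
    verts-unique   : Unique verts
    verts-complete : ∀ v → v ∈ verts
open Graph public

-- Vertices coloured black when Z is the initial black set and the colour-change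
-- rule is applied repeatedly (the final colouring, independent of the order).
data Black (G : SimpleGraph) (Z : List (V G)) : V G → Set where
  init  : ∀ {v} → v ∈ Z → Black G Z v
  force : ∀ {u v} → Black G Z u → _~_ G u v →
          (∀ w → _~_ G u w → ¬ (w ≡ v) → Black G Z w) →
          Black G Z v

IsZFS : (G : SimpleGraph) → List (V G) → Set
IsZFS G Z = Unique Z × (∀ v → Black G Z v)

-- IsZFNumber G k  :⇔  k = Z(G), the minimum size of a zero forcing set.
-- (For the graph with no vertices the empty set is zero forcing, so Z = 0,
-- matching the paper's convention.)
IsZFNumber : SimpleGraph → ℕ → Set
IsZFNumber G k =
  (Σ (List (V G)) λ Z → IsZFS G Z × length Z ≡ k) ×
  (∀ Z → IsZFS G Z → k ≤ length Z)

-- Generalized corona G ≺ H_v ≻ : the graph H v is attached to the vertex v of G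
-- (the paper's H_i attached to v_i; indexing by vertices instead of by i is
-- just the labelling v_1..v_n).
CoronaV : (G : Graph) → (V (graph G) → Graph) → Set
CoronaV G H = V (graph G) ⊎ Σ (V (graph G)) (λ v → V (graph (H v)))

data CoronaAdj (G : Graph) (H : V (graph G) → Graph) : CoronaV G H → CoronaV G H → Set where
  inG   : ∀ {a b} → _~_ (graph G) a b → CoronaAdj G H (inj₁ a) (inj₁ b)
  inH   : ∀ {v x y} → _~_ (graph (H v)) x y → CoronaAdj G H (inj₂ (v , x)) (inj₂ (v , y))
  join₁ : ∀ {v x} → CoronaAdj G H (inj₁ v) (inj₂ (v , x))
  join₂ : ∀ {v x} → CoronaAdj G H (inj₂ (v , x)) (inj₁ v)

corona-sym : ∀ G H {a b} → CoronaAdj G H a b → CoronaAdj G H b a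
corona-sym G H (inG p) = inG (sym~ (graph G) p)
corona-sym G H (inH {v} p) = inH (sym~ (graph (H v)) p)
corona-sym G H join₁ = join₂
corona-sym G H join₂ = join₁

corona-irrefl : ∀ G H {a} → ¬ CoronaAdj G H a a
corona-irrefl G H (inG p) = irrefl~ (graph G) p
corona-irrefl G H (inH {v} p) = irrefl~ (graph (H v)) p

corona : (G : Graph) → (V (graph G) → Graph) → SimpleGraph
corona G H = record
  { V = CoronaV G H ; _~_ = CoronaAdj G H
  ; sym~ = corona-sym G H ; irrefl~ = corona-irrefl G H }

module Submission where

-- Take a minimum zero forcing set ZG of G and minimum zero forcing sets ZH v
-- of the attached graphs, and let  seeds = ZG ∪ ⋃_v ZH v  (as a disjoint union
-- of vertex sets of the corona).  It suffices to show that seeds is a zero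
-- forcing set of the corona of the required size; minimality of Z(corona)
-- then gives the bound.
--
--  * Size and distinctness: the parts live in different summands / fibres of
--    the corona's vertex type, so seeds is duplicate-free and its length is
--    |ZG| + Σ_v |ZH v|.
--  * Forcing: once v is black, every force inside H_v is also a force in the
--    corona, because the only extra neighbour of an H_v-vertex is v itself
--    (pendant-black).  Every force u → w of G is a force of the corona: the
--    extra neighbours of u are the vertices of H_u, which are black by the
--    previous point since u is black (base-black).

open import Defs
open import Data.Nat using (ℕ; _≤_; _+_)
open import Data.Nat.ListAction using (sum)
open import Data.List using (List; []; _∷_; _++_; length; map)
open import Data.List.Properties using (length-++; length-map)
open import Data.List.Membership.Propositional using (_∈_)
open import Data.List.Membership.Propositional.Properties
  using (∈-map⁺; ∈-map⁻; ∈-++⁺ˡ; ∈-++⁺ʳ; ∈-++⁻)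
open import Data.List.Relation.Unary.Any using (here; there)
open import Data.List.Relation.Unary.All.Properties using (All¬⇒¬Any)
open import Data.List.Relation.Unary.AllPairs using ([]; _∷_)
open import Data.List.Relation.Unary.Unique.Propositional using (Unique)
import Data.List.Relation.Unary.Unique.Propositional.Properties as Unique
open import Data.Sum using (inj₁; inj₂)
open import Data.Sum.Properties using (inj₁-injective)
open import Data.Product using (Σ; _×_; _,_; proj₁; proj₂)
open import Relation.Binary.PropositionalEquality
  using (_≡_; refl; cong; cong₂; subst; module ≡-Reasoning)
open import Relation.Nullary using (¬_)

module CoronaSeeds (G : Graph) (H : V (graph G) → Graph) where

  private
    VG : Set
    VG = V (graph G)

    VC : Set
    VC = CoronaV G H

  pendant : (v : VG) → V (graph (H v)) → VC
  pendant v h = inj₂ (v , h)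

  pendant-injective : ∀ v {x y} → pendant v x ≡ pendant v y → x ≡ y
  pendant-injective v refl = refl

  module _ (ZG : List VG) (ZH : (v : VG) → List (V (graph (H v)))) where

    pendantSeeds : List VG → List VC
    pendantSeeds []       = []
    pendantSeeds (v ∷ vs) = map (pendant v) (ZH v) ++ pendantSeeds vs

    seeds : List VC
    seeds = map inj₁ ZG ++ pendantSeeds (verts G)

    ∈-pendantSeeds⁺ : ∀ {u x} vs → u ∈ vs → x ∈ ZH u → pendant u x ∈ pendantSeeds vs
    ∈-pendantSeeds⁺ (v ∷ vs) (here refl) x∈ = ∈-++⁺ˡ (∈-map⁺ (pendant v) x∈)
    ∈-pendantSeeds⁺ (v ∷ vs) (there u∈) x∈ =
      ∈-++⁺ʳ (map (pendant v) (ZH v)) (∈-pendantSeeds⁺ vs u∈ x∈)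

    ∈-pendantSeeds⁻ : ∀ vs {w} → w ∈ pendantSeeds vs →
                      Σ VG λ u → Σ (V (graph (H u))) λ x → (w ≡ pendant u x) × (u ∈ vs)
    ∈-pendantSeeds⁻ (v ∷ vs) w∈ with ∈-++⁻ (map (pendant v) (ZH v)) w∈
    ... | inj₁ w∈ZHv with ∈-map⁻ (pendant v) w∈ZHv
    ...   | x , _ , w≡ = v , x , w≡ , here refl
    ∈-pendantSeeds⁻ (v ∷ vs) w∈ | inj₂ w∈rest with ∈-pendantSeeds⁻ vs w∈rest
    ...   | u , x , w≡ , u∈ = u , x , w≡ , there u∈

    -- Blocks over distinct vertices are disjoint, so the union is duplicate-free.
    pendantSeeds-unique : (∀ v → Unique (ZH v)) → ∀ vs → Unique vs → Unique (pendantSeeds vs)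
    pendantSeeds-unique uH []       _           = []
    pendantSeeds-unique uH (v ∷ vs) (v∉ ∷ uvs) =
      Unique.++⁺ (Unique.map⁺ (pendant-injective v) (uH v)) (pendantSeeds-unique uH vs uvs) disjoint
      where
      disjoint : ∀ {w} → ¬ (w ∈ map (pendant v) (ZH v) × w ∈ pendantSeeds vs)
      disjoint (w∈ZHv , w∈rest) with ∈-map⁻ (pendant v) w∈ZHv | ∈-pendantSeeds⁻ vs w∈rest
      ... | _ , _ , refl | _ , _ , refl , v∈ = All¬⇒¬Any v∉ v∈

    -- The base part lies in the summand V(G), the pendant part in the other one.
    seeds-unique : Unique ZG → (∀ v → Unique (ZH v)) → Unique seeds
    seeds-unique uG uH =
      Unique.++⁺ (Unique.map⁺ inj₁-injective uG)
                 (pendantSeeds-unique uH (verts G) (verts-unique G)) disjoint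
      where
      disjoint : ∀ {w} → ¬ (w ∈ map inj₁ ZG × w ∈ pendantSeeds (verts G))
      disjoint (w∈ZG , w∈rest) with ∈-map⁻ inj₁ w∈ZG | ∈-pendantSeeds⁻ (verts G) w∈rest
      ... | _ , _ , refl | _ , _ , () , _

    length-pendantSeeds : (zH : VG → ℕ) → (∀ v → length (ZH v) ≡ zH v) →
                          ∀ vs → length (pendantSeeds vs) ≡ sum (map zH vs)
    length-pendantSeeds zH |ZH| []       = refl
    length-pendantSeeds zH |ZH| (v ∷ vs) = begin
      length (map (pendant v) (ZH v) ++ pendantSeeds vs)
        ≡⟨ length-++ (map (pendant v) (ZH v)) ⟩
      length (map (pendant v) (ZH v)) + length (pendantSeeds vs)
        ≡⟨ cong₂ _+_ (length-map (pendant v) (ZH v)) (length-pendantSeeds zH |ZH| vs) ⟩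
      length (ZH v) + sum (map zH vs)
        ≡⟨ cong (_+ sum (map zH vs)) (|ZH| v) ⟩
      zH v + sum (map zH vs) ∎
      where open ≡-Reasoning

    length-seeds : (zG : ℕ) (zH : VG → ℕ) → length ZG ≡ zG → (∀ v → length (ZH v) ≡ zH v) →
                   length seeds ≡ zG + sum (map zH (verts G))
    length-seeds zG zH |ZG| |ZH| = begin
      length (map inj₁ ZG ++ pendantSeeds (verts G))
        ≡⟨ length-++ (map inj₁ ZG) ⟩
      length (map inj₁ ZG) + length (pendantSeeds (verts G))
        ≡⟨ cong₂ _+_ (length-map inj₁ ZG) (length-pendantSeeds zH |ZH| (verts G)) ⟩
      length ZG + sum (map zH (verts G))
        ≡⟨ cong (_+ sum (map zH (verts G))) |ZG| ⟩
      zG + sum (map zH (verts G)) ∎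
      where open ≡-Reasoning

    -- Once u is black in the corona, whatever ZH u forces in H u is forced
    -- in the corona too: the only neighbour of an H u-vertex outside H u is u.
    pendant-black : ∀ u → Black (corona G H) seeds (inj₁ u) →
                    ∀ x → Black (graph (H u)) (ZH u) x → Black (corona G H) seeds (pendant u x)
    pendant-black u u-black x (init x∈) =
      init (∈-++⁺ʳ (map inj₁ ZG) (∈-pendantSeeds⁺ (verts G) (verts-complete G u) x∈))
    pendant-black u u-black x (force {h} h-black h~x others) =
      force (pendant-black u u-black h h-black) (inH h~x) othersC
      where
      othersC : ∀ w → CoronaAdj G H (pendant u h) w → ¬ (w ≡ pendant u x) → Black (corona G H) seeds w
      othersC _ (inH {y = y} h~y) y≢x =
        pendant-black u u-black y (others y h~y (λ y≡x → y≢x (cong (pendant u) y≡x)))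
      othersC _ join₂             _   = u-black

    -- If every ZH v forces all of H v, then whatever ZG forces in G is forced
    -- in the corona: the extra neighbours of a forcing vertex u are the
    -- vertices of H u, already black by pendant-black.
    base-black : (∀ v y → Black (graph (H v)) (ZH v) y) →
                 ∀ u → Black (graph G) ZG u → Black (corona G H) seeds (inj₁ u)
    base-black bH u (init u∈) = init (∈-++⁺ˡ (∈-map⁺ inj₁ u∈))
    base-black bH v (force {u} u-black u~v others) =
      force (base-black bH u u-black) (inG u~v) othersC
      where
      othersC : ∀ w → CoronaAdj G H (inj₁ u) w → ¬ (w ≡ inj₁ v) → Black (corona G H) seeds w
      othersC _ (inG {b = b} u~b) b≢v =
        base-black bH b (others b u~b (λ b≡v → b≢v (cong inj₁ b≡v)))
      othersC _ (join₁ {x = x})  _   = pendant-black u (base-black bH u u-black) x (bH u x)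

    seeds-zfs : IsZFS (graph G) ZG → (∀ v → IsZFS (graph (H v)) (ZH v)) →
                IsZFS (corona G H) seeds
    seeds-zfs (uG , bG) zfsH = seeds-unique uG (λ v → proj₁ (zfsH v)) , all-black
      where
      bH : ∀ v y → Black (graph (H v)) (ZH v) y
      bH v = proj₂ (zfsH v)

      all-black : ∀ w → Black (corona G H) seeds w
      all-black (inj₁ u)       = base-black bH u (bG u)
      all-black (inj₂ (u , x)) = pendant-black u (base-black bH u (bG u)) x (bH u x)

open CoronaSeeds

theorem4p20 : (G : Graph) (H : V (graph G) → Graph)
    (zG : ℕ) (zH : V (graph G) → ℕ) (zC : ℕ) →
    IsZFNumber (graph G) zG →
    (∀ v → IsZFNumber (graph (H v)) (zH v)) →
    IsZFNumber (corona G H) zC →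
    zC ≤ zG + sum (map zH (verts G))
theorem4p20 G H zG zH zC ((ZG , zfsG , |ZG|) , _) optH (_ , minimalC) =
  subst (zC ≤_) (length-seeds G H ZG ZH zG zH |ZG| |ZH|)
        (minimalC (seeds G H ZG ZH) (seeds-zfs G H ZG ZH zfsG zfsH))
  where
  ZH : ∀ v → List (V (graph (H v)))
  ZH v = proj₁ (proj₁ (optH v))

  zfsH : ∀ v → IsZFS (graph (H v)) (ZH v)
  zfsH v = proj₁ (proj₂ (proj₁ (optH v)))

  |ZH| : ∀ v → length (ZH v) ≡ zH v
  |ZH| v = proj₂ (proj₂ (proj₁ (optH v)))
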